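{- Let $G=(V,E)$ be a $\delta$-regular equatorial graph with girth $3$ and equator $q$. Then $q\equiv 0\pmod 3$ or $\delta\equiv 2\pmod 3$. Moreover, $V$ can be partitioned into $q$ parts $L_0,\dots,L_{q-1}$, each inducing a clique, such that $E$ consists exactly of the edges inside the parts together with all edges $uv$ with $u\in L_i$, $v\in L_{i+1}$ (indices mod $q$). Furthermore: if $q\equiv0\pmod 3$, there are positive integers $n_0,n_1,n_2$ with $n_0+n_1+n_2=\delta+1$ and $|L_i|=n_j$ whenever $i\equiv j\pmod 3$; if $q\not\equiv0\pmod3$, then $|L_i|=\frac{\delta+1}{3}$ for all $i$.
   Context: A cycle $C$ in $G$ is isometric if $d_C(x,y)=d_G(x,y)$ for all $x,y\in V(C)$; the equator is the length of a longest isometric cycle. For $\delta\ge2$, $g\ge3$, $k=\lceil g/2\rceil-1$, the Moore bound is $M(\delta,g)=1+\sum_{i=0}^{k-1}\delta(\delta-1)^i$ for odd $g$ and $M(\delta,g)=2+\sum_{i=1}^{k}2(\delta-1)^i$ for even $g$ (so $M(\delta,3)=\delta+1$). An equatorial graph is a finite graph with girth $g$, minimum degree $\delta$ and equator $q>6k+3$ whose order is exactly $\frac{q}{g}M(\delta,g)$; for $g=3$ this means $q>9$ and order $\frac{q(\delta+1)}{3}$. -}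

module Defs where

open import Data.Nat using (ℕ; zero; suc; _+_; _*_; _∸_; _≤_; _<_; _⊓_; ∣_-_∣)
open import Data.Fin using (Fin; toℕ) renaming (_≟_ to _≟ᶠ_)
open import Data.Fin.Properties using ()
open import Data.Bool using (Bool; true; false; T)
open import Data.List using (List; length; filter)
open import Data.List.Base using ()
open import Data.List using (allFin)
open import Data.Product using (Σ; _×_; ∃)
open import Data.Sum using (_⊎_)
open import Relation.Nullary using (¬_)
open import Relation.Nullary.Decidable using (T?)
open import Relation.Binary.PropositionalEquality using (_≡_; _≢_)
open import Function.Definitions using (Injective)

record Graph (n : ℕ) : Set where
  field
    adj   : Fin n → Fin n → Bool
    sym   : ∀ u v → adj u v ≡ adj v u
    irrefl : ∀ v → adj v v ≡ false

open Graph public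

Adj : ∀ {n} → Graph n → Fin n → Fin n → Set
Adj G u v = T (adj G u v)

degree : ∀ {n} → Graph n → Fin n → ℕ
degree {n} G v = length (filter (λ w → T? (adj G v w)) (allFin n))

Regular : ∀ {n} → Graph n → ℕ → Set
Regular G d = ∀ v → degree G v ≡ d

MinDegree : ∀ {n} → Graph n → ℕ → Set
MinDegree {n} G d = (∀ v → d ≤ degree G v) × Σ (Fin n) (λ v → degree G v ≡ d)

data Walk {n} (G : Graph n) : Fin n → Fin n → ℕ → Set where
  here : ∀ {x} → Walk G x x 0
  step : ∀ {x y z k} → Adj G x y → Walk G y z k → Walk G x z (suc k)

IsDist : ∀ {n} → Graph n → Fin n → Fin n → ℕ → Set
IsDist G x y d = Walk G x y d × (∀ k → k < d → ¬ Walk G x y k)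

Consec : ℕ → ℕ → ℕ → Set
Consec L a b = (suc a ≡ b) ⊎ ((suc a ≡ L) × (b ≡ 0))

record Cycle {n} (G : Graph n) (L : ℕ) : Set where
  field
    vertex : Fin L → Fin n
    inj    : Injective _≡_ _≡_ vertex
    len≥3  : 3 ≤ L
    edges  : ∀ i j → Consec L (toℕ i) (toℕ j) → Adj G (vertex i) (vertex j)

open Cycle public

cycDist : ℕ → ℕ → ℕ → ℕ
cycDist L a b = ∣ a - b ∣ ⊓ (L ∸ ∣ a - b ∣)

Isometric : ∀ {n} {G : Graph n} {L} → Cycle G L → Set
Isometric {G = G} {L} C =
  ∀ i j → IsDist G (vertex C i) (vertex C j) (cycDist L (toℕ i) (toℕ j))

Girth : ∀ {n} → Graph n → ℕ → Set
Girth G g = Cycle G g × (∀ L → Cycle G L → g ≤ L)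

Equator : ∀ {n} → Graph n → ℕ → Set
Equator G q = Σ (Cycle G q) Isometric × (∀ L (C : Cycle G L) → Isometric C → L ≤ q)

partSize : ∀ {n q} → (Fin n → Fin q) → Fin q → ℕ
partSize {n} part i = length (filter (λ v → part v ≟ᶠ i) (allFin n))

{-# OPTIONS --safe #-}
module Submission where

-- Let c₀, …, c_{q-1} be an isometric cycle of length q ≥ 9 (only this, regularity and the
-- order equation 3n = q(δ + 1) are used).  If a vertex v lies in N[cᵢ] and N[cⱼ] then
-- d(cᵢ, cⱼ) ≤ 2, so the indices i with v ∈ N[cᵢ] form a set of cyclic diameter ≤ 2: at most
-- three of them, and exactly three only for a block i - 1, i, i + 1, whose centre i we call
-- the part of v.  There are q(δ + 1) = 3n pairs (v, i) with v ∈ N[cᵢ], so every vertex is in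
-- exactly three such neighbourhoods.  Adjacent vertices have parts at cyclic distance ≤ 1,
-- since all indices near either part are within distance 3 of each other; conversely
-- N[u] ⊆ N[c_{part u}] and both have δ + 1 elements, so they are equal.  Counting N[c_{i+1}]
-- gives |Lᵢ| + |L_{i+1}| + |L_{i+2}| = δ + 1, so the part sizes are 3-periodic, and constant
-- when 3 ∤ q, which forces δ ≡ 2 (mod 3).  The statements about the cycle are reduced, by a
-- rotation, to a fixed position, where they are decided by computation.

open import Data.Bool using (Bool; true; false; T; _∨_)
open import Data.Bool.Properties using (T-≡)
open import Data.Empty using (⊥-elim)
open import Data.Fin using (Fin; toℕ; _≟_) renaming (zero to 0F; suc to fsuc)
open import Data.Fin.Patterns using (1F; 2F; 3F; 4F; 5F; 6F; 7F; 8F)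
open import Data.Fin.Permutation using (permutation)
open import Data.Fin.Properties using (toℕ-injective; toℕ<n; toℕ-fromℕ<; any?)
open import Data.List using (length; filter; tabulate)
open import Data.Nat
  using (ℕ; zero; suc; _+_; _*_; _∸_; _≤_; _<_; _%_; _/_; _⊓_; ∣_-_∣; z≤n; s≤s; NonZero; >-nonZero⁻¹)
  renaming (_≟_ to _≟ℕ_)
open import Data.Nat.DivMod
  using (_mod_; m%n<n; m<n⇒m%n≡m; %-distribˡ-+; m%n%n≡m%n; [m+n]%n≡m%n; [m+kn]%n≡m%n; n%n≡0; m≡m%n+[m/n]*n)
open import Data.Nat.Properties hiding (_≟_)
open import Data.Product using (Σ; _×_; ∃; ∃-syntax; _,_; proj₁; proj₂)
import Data.Product as Prod
open import Data.Sum using (_⊎_; inj₁; inj₂; [_,_])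
import Data.Sum as Sum
open import Data.Unit using (tt)
open import Defs hiding (sym)
open import Function using (_∘_; id)
open import Function.Bundles using (_⇔_; mk⇔; Equivalence)
open import Function.Properties.Equivalence using () renaming (refl to ⇔-refl; sym to ⇔-sym; trans to ⇔-trans)
open import Relation.Binary.PropositionalEquality
  using (_≡_; _≢_; refl; sym; trans; cong; cong₂; subst; subst₂; module ≡-Reasoning)
open import Relation.Nullary using (¬_; Dec; yes; no; does; contradiction; _⊎-dec_; _×-dec_)
open import Relation.Nullary.Decidable using (T?; dec-false)
open import Relation.Unary using (Pred; Decidable)
open import Algebra.Properties.CommutativeMonoid.Sum +-0-commutativeMonoid
  using (sum; sum-syntax; ∑-comm; ∑-distrib-+; sum-cong-≗; sum-permute; sum-remove)

open Equivalence using (to; from)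

-- Counting

χ : Bool → ℕ
χ true  = 1
χ false = 0

count : ∀ {m} → (Fin m → Bool) → ℕ
count {m} P = ∑[ i < m ] χ (P i)

T-does⇔ : ∀ {a} {A : Set a} (a? : Dec A) → T (does a?) ⇔ A
T-does⇔ (yes a) = mk⇔ (λ _ → a) (λ _ → tt)
T-does⇔ (no ¬a) = mk⇔ (λ ()) ¬a

length-filter-tabulate : ∀ {a p} {A : Set a} {P : Pred A p} (P? : Decidable P) {m} (f : Fin m → A) →
  length (filter P? (tabulate f)) ≡ ∑[ i < m ] χ (does (P? (f i)))
length-filter-tabulate P? {zero}  f = refl
length-filter-tabulate P? {suc m} f with does (P? (f 0F))
... | true  = cong suc (length-filter-tabulate P? (f ∘ fsuc))
... | false = length-filter-tabulate P? (f ∘ fsuc)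

∑-const : ∀ m c → ∑[ i < m ] c ≡ m * c
∑-const zero    c = refl
∑-const (suc m) c = cong (c +_) (∑-const m c)

∑-mono-≤ : ∀ {m} {f g : Fin m → ℕ} → (∀ i → f i ≤ g i) → sum f ≤ sum g
∑-mono-≤ {zero}  f≤g = z≤n
∑-mono-≤ {suc m} f≤g = +-mono-≤ (f≤g 0F) (∑-mono-≤ (f≤g ∘ fsuc))

∑-tight : ∀ {m} {f g : Fin m → ℕ} → (∀ i → f i ≤ g i) → sum f ≡ sum g → ∀ i → f i ≡ g i
∑-tight {suc m} {f} {g} f≤g eq = λ { 0F → head≡ ; (fsuc i) → ∑-tight (f≤g ∘ fsuc) tail≡ i }
  where
  head≡ : f 0F ≡ g 0F
  head≡ = ≤-antisym (f≤g 0F) (+-cancelʳ-≤ _ _ _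
    (≤-trans (+-monoʳ-≤ (g 0F) (∑-mono-≤ (f≤g ∘ fsuc))) (≤-reflexive (sym eq))))
  tail≡ : sum (f ∘ fsuc) ≡ sum (g ∘ fsuc)
  tail≡ = +-cancelˡ-≡ (f 0F) _ _ (trans eq (cong (_+ _) (sym head≡)))

χ-mono : ∀ {a b} → (T a → T b) → χ a ≤ χ b
χ-mono {false}         _   = z≤n
χ-mono {true}  {true}  _   = ≤-refl
χ-mono {true}  {false} a⇒b = ⊥-elim (a⇒b tt)

χ-≡⇒T : ∀ {a b} → χ a ≡ χ b → T b → T a
χ-≡⇒T {true}  {true}  _ _ = tt

χ-T : ∀ {b} → T b → χ b ≡ 1
χ-T {true} _ = refl

χ-¬T : ∀ {b} → ¬ T b → χ b ≡ 0
χ-¬T {true}  ¬b = ⊥-elim (¬b tt)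
χ-¬T {false} _  = refl

count-⊆⇒⊇ : ∀ {m} {P Q : Fin m → Bool} → (∀ i → T (P i) → T (Q i)) → count P ≡ count Q →
  ∀ i → T (Q i) → T (P i)
count-⊆⇒⊇ P⊆Q eq i = χ-≡⇒T (∑-tight (λ j → χ-mono (P⊆Q j)) eq i)

count-≥1 : ∀ {m} {P : Fin m → Bool} i → T (P i) → 1 ≤ count P
count-≥1 {suc m} {P} i Pi = ≤-trans (χ-mono {true} (λ _ → Pi))
  (≤-trans (m≤m+n _ _) (≤-reflexive (sym (sum-remove {i = i} (χ ∘ P)))))

count-none : ∀ {m} {P : Fin m → Bool} → (∀ i → ¬ T (P i)) → count P ≡ 0
count-none {m} ¬P = trans (sum-cong-≗ (χ-¬T ∘ ¬P)) (trans (∑-const m 0) (*-zeroʳ m))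

count-insert : ∀ {m} (P : Fin m → Bool) x → P x ≡ false →
  count (λ w → does (w ≟ x) ∨ P w) ≡ suc (count P)
count-insert {suc m} P 0F       Px≡false = cong (λ b → suc (χ b + count (P ∘ fsuc))) (sym Px≡false)
count-insert {suc m} P (fsuc x) Px≡false =
  trans (cong (χ (P 0F) +_) (count-insert (P ∘ fsuc) x Px≡false)) (+-suc (χ (P 0F)) _)

χ-one-of-three : ∀ {m} {x y₁ y₂ y₃ : Fin m} {b} → y₁ ≢ y₂ → y₁ ≢ y₃ → y₂ ≢ y₃ →
  T b ⇔ (x ≡ y₁ ⊎ x ≡ y₂ ⊎ x ≡ y₃) →
  χ b ≡ χ (does (x ≟ y₁)) + χ (does (x ≟ y₂)) + χ (does (x ≟ y₃))
χ-one-of-three {x = x} {y₁} {y₂} {y₃} y₁≢y₂ y₁≢y₃ y₂≢y₃ b⇔ with x ≟ y₁ | x ≟ y₂ | x ≟ y₃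
... | yes refl | yes refl | _        = contradiction refl y₁≢y₂
... | yes refl | no _     | yes refl = contradiction refl y₁≢y₃
... | no _     | yes refl | yes refl = contradiction refl y₂≢y₃
... | yes refl | no _     | no _     = χ-T (from b⇔ (inj₁ refl))
... | no _     | yes refl | no _     = χ-T (from b⇔ (inj₂ (inj₁ refl)))
... | no _     | no _     | yes refl = χ-T (from b⇔ (inj₂ (inj₂ refl)))
... | no x≢y₁  | no x≢y₂  | no x≢y₃  = χ-¬T ([ x≢y₁ , [ x≢y₂ , x≢y₃ ] ] ∘ to b⇔)

-- The cycle graph on Fin q: rotation, adjacency and distance

Consec? : ∀ L a b → Dec (Consec L a b)
Consec? L a b = suc a ≟ℕ b ⊎-dec (suc a ≟ℕ L ×-dec b ≟ℕ 0)

module CycleGraph (q : ℕ) .{{_ : NonZero q}} where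

  open ≡-Reasoning

  fin : ℕ → Fin q
  fin k = k mod q

  toℕ-fin : ∀ k → toℕ (fin k) ≡ k % q
  toℕ-fin k = toℕ-fromℕ< (m%n<n k q)

  fin-toℕ : ∀ i → fin (toℕ i) ≡ i
  fin-toℕ i = toℕ-injective (trans (toℕ-fin (toℕ i)) (m<n⇒m%n≡m (toℕ<n i)))

  fin-% : ∀ {k l} → k % q ≡ l % q → fin k ≡ fin l
  fin-% e = toℕ-injective (trans (toℕ-fin _) (trans e (sym (toℕ-fin _))))

  infixl 6 _⊕_
  _⊕_ : Fin q → ℕ → Fin q
  i ⊕ s = fin (toℕ i + s)

  fin-⊕ : ∀ k s → fin k ⊕ s ≡ fin (k + s)
  fin-⊕ k s = fin-% (begin
    (toℕ (fin k) + s) % q   ≡⟨ cong (λ x → (x + s) % q) (toℕ-fin k) ⟩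
    (k % q + s) % q         ≡⟨ %-distribˡ-+ (k % q) s q ⟩
    (k % q % q + s % q) % q ≡⟨ cong (λ x → (x + s % q) % q) (m%n%n≡m%n k q) ⟩
    (k % q + s % q) % q     ≡⟨ %-distribˡ-+ k s q ⟨
    (k + s) % q             ∎)

  ⊕-assoc : ∀ i s t → i ⊕ s ⊕ t ≡ i ⊕ (s + t)
  ⊕-assoc i s t = trans (fin-⊕ (toℕ i + s) t) (cong fin (+-assoc (toℕ i) s t))

  ⊕-identityʳ : ∀ i → i ⊕ 0 ≡ i
  ⊕-identityʳ i = trans (cong fin (+-identityʳ (toℕ i))) (fin-toℕ i)

  ⊕-period : ∀ i → i ⊕ q ≡ i
  ⊕-period i = trans (fin-% ([m+n]%n≡m%n (toℕ i) q)) (fin-toℕ i)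

  ⊕-comm : ∀ i s → i ⊕ s ≡ fin s ⊕ toℕ i
  ⊕-comm i s = trans (cong fin (+-comm (toℕ i) s)) (sym (fin-⊕ s (toℕ i)))

  ⊕-inverseʳ : ∀ {s} i → s ≤ q → i ⊕ s ⊕ (q ∸ s) ≡ i
  ⊕-inverseʳ i s≤q = trans (⊕-assoc i _ _) (trans (cong (i ⊕_) (m+[n∸m]≡n s≤q)) (⊕-period i))

  ⊕-inverseˡ : ∀ {s} i → s ≤ q → i ⊕ (q ∸ s) ⊕ s ≡ i
  ⊕-inverseˡ i s≤q = trans (⊕-assoc i _ _) (trans (cong (i ⊕_) (m∸n+n≡m s≤q)) (⊕-period i))

  ⊕-injective : ∀ {s i j} → s ≤ q → i ⊕ s ≡ j ⊕ s → i ≡ j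
  ⊕-injective {s} {i} {j} s≤q e = begin
    i                 ≡⟨ ⊕-inverseʳ i s≤q ⟨
    i ⊕ s ⊕ (q ∸ s)   ≡⟨ cong (_⊕ (q ∸ s)) e ⟩
    j ⊕ s ⊕ (q ∸ s)   ≡⟨ ⊕-inverseʳ j s≤q ⟩
    j                 ∎

  ⊕-surjective : ∀ {s} → s ≤ q → ∀ j → ∃[ i ] i ⊕ s ≡ j
  ⊕-surjective s≤q j = j ⊕ _ , ⊕-inverseˡ j s≤q

  ⊕-cancelˡ : ∀ i {s t} → i ⊕ s ≡ i ⊕ t → fin s ≡ fin t
  ⊕-cancelˡ i {s} {t} e =
    ⊕-injective (<⇒≤ (toℕ<n i)) (trans (sym (⊕-comm i s)) (trans e (⊕-comm i t)))

  ⊕-injectiveʳ : ∀ i {s t} → s < q → t < q → i ⊕ s ≡ i ⊕ t → s ≡ t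
  ⊕-injectiveʳ i {s} {t} s<q t<q e = begin
    s           ≡⟨ m<n⇒m%n≡m s<q ⟨
    s % q       ≡⟨ toℕ-fin s ⟨
    toℕ (fin s) ≡⟨ cong toℕ (⊕-cancelˡ i e) ⟩
    toℕ (fin t) ≡⟨ toℕ-fin t ⟩
    t % q       ≡⟨ m<n⇒m%n≡m t<q ⟩
    t           ∎

  ⊕-reach : ∀ i j → ∃[ s ] s < q × i ⊕ s ≡ j
  ⊕-reach i j with k , k⊕i≡j ← ⊕-surjective (<⇒≤ (toℕ<n i)) j =
    toℕ k , toℕ<n k , trans (⊕-comm i (toℕ k)) (trans (cong (_⊕ toℕ i) (fin-toℕ k)) k⊕i≡j)

  next : Fin q → Fin q
  next i = i ⊕ 1

  ⊕-suc : ∀ i s → i ⊕ suc s ≡ next i ⊕ s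
  ⊕-suc i s = sym (⊕-assoc i 1 s)

  next-injective : ∀ {i j} → next i ≡ next j → i ≡ j
  next-injective = ⊕-injective (>-nonZero⁻¹ q)

  Consec-next : ∀ i → Consec q (toℕ i) (toℕ (next i))
  Consec-next i with m≤n⇒m<n∨m≡n (toℕ<n i)
  ... | inj₁ 1+i<q = inj₁ (sym (begin
    toℕ (next i)     ≡⟨ toℕ-fin _ ⟩
    (toℕ i + 1) % q  ≡⟨ cong (_% q) (+-comm (toℕ i) 1) ⟩
    suc (toℕ i) % q  ≡⟨ m<n⇒m%n≡m 1+i<q ⟩
    suc (toℕ i)      ∎))
  ... | inj₂ 1+i≡q = inj₂ (1+i≡q , (begin
    toℕ (next i)     ≡⟨ toℕ-fin _ ⟩
    (toℕ i + 1) % q  ≡⟨ cong (_% q) (trans (+-comm (toℕ i) 1) 1+i≡q) ⟩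
    q % q            ≡⟨ n%n≡0 q ⟩
    0                ∎))

  Consec-unique : ∀ {a b c} → b < q → c < q → Consec q a b → Consec q a c → b ≡ c
  Consec-unique _   _   (inj₁ e)       (inj₁ e')       = trans (sym e) e'
  Consec-unique _   _   (inj₂ (_ , e)) (inj₂ (_ , e')) = trans e (sym e')
  Consec-unique b<q _   (inj₁ e)       (inj₂ (e' , _)) = contradiction (trans (sym e) e') (<⇒≢ b<q)
  Consec-unique _   c<q (inj₂ (e , _)) (inj₁ e')       = contradiction (trans (sym e') e) (<⇒≢ c<q)

  Consec⇔next : ∀ {i j} → Consec q (toℕ i) (toℕ j) ⇔ j ≡ next i
  Consec⇔next {i} {j} = mk⇔
    (λ c → toℕ-injective (Consec-unique (toℕ<n j) (toℕ<n (next i)) c (Consec-next i)))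
    (λ { refl → Consec-next i })

  Near : Fin q → Fin q → Set
  Near i j = i ≡ j ⊎ Consec q (toℕ i) (toℕ j) ⊎ Consec q (toℕ j) (toℕ i)

  Near? : ∀ i j → Dec (Near i j)
  Near? i j = i ≟ j ⊎-dec Consec? q (toℕ i) (toℕ j) ⊎-dec Consec? q (toℕ j) (toℕ i)

  Near-bound : ∀ {i j} → Near i j → 1 ≤ toℕ i → toℕ j ≤ suc (toℕ i)
  Near-bound (inj₁ refl)                    _   = n≤1+n _
  Near-bound (inj₂ (inj₁ (inj₁ e)))         _   = ≤-reflexive (sym e)
  Near-bound (inj₂ (inj₁ (inj₂ (_ , e))))   _   = subst (_≤ _) (sym e) z≤n
  Near-bound (inj₂ (inj₂ (inj₁ e)))         _   = ≤-trans (n≤1+n _) (≤-trans (≤-reflexive e) (n≤1+n _))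
  Near-bound (inj₂ (inj₂ (inj₂ (_ , e))))   1≤i = contradiction e (>⇒≢ 1≤i)

  Near⇔ : ∀ {i j} → Near i j ⇔ (i ≡ j ⊎ j ≡ next i ⊎ i ≡ next j)
  Near⇔ = mk⇔ (Sum.map₂ (Sum.map (to Consec⇔next) (to Consec⇔next)))
              (Sum.map₂ (Sum.map (from Consec⇔next) (from Consec⇔next)))

  Near-refl : ∀ {i} → Near i i
  Near-refl = inj₁ refl

  consecutive⇒Near : ∀ {i j} → suc (toℕ i) ≡ toℕ j → Near i j
  consecutive⇒Near e = inj₂ (inj₁ (inj₁ e))

  Near-sym : ∀ {i j} → Near i j → Near j i
  Near-sym (inj₁ e)        = inj₁ (sym e)
  Near-sym (inj₂ (inj₁ c)) = inj₂ (inj₂ c)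
  Near-sym (inj₂ (inj₂ c)) = inj₂ (inj₁ c)

  Near-next : ∀ {i j} → Near (next i) (next j) ⇔ Near i j
  Near-next = mk⇔
    (from Near⇔ ∘ Sum.map next-injective (Sum.map next-injective next-injective) ∘ to Near⇔)
    (from Near⇔ ∘ Sum.map (cong next) (Sum.map (cong next) (cong next)) ∘ to Near⇔)

  Near-⊕ : ∀ {i j} s → Near (i ⊕ s) (j ⊕ s) ⇔ Near i j
  Near-⊕ {i} {j} zero    = subst₂ (λ a b → Near a b ⇔ Near i j)
    (sym (⊕-identityʳ i)) (sym (⊕-identityʳ j)) ⇔-refl
  Near-⊕ {i} {j} (suc s) = subst₂ (λ a b → Near a b ⇔ Near i j)
    (sym (⊕-suc i s)) (sym (⊕-suc j s)) (⇔-trans (Near-⊕ s) Near-next)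

  Near-⊕1⇔ : ∀ {m i} → Near m (i ⊕ 1) ⇔ (m ≡ i ⊎ m ≡ i ⊕ 1 ⊎ m ≡ i ⊕ 2)
  Near-⊕1⇔ {m} {i} = ⇔-trans Near⇔ (mk⇔ to′ from′)
    where
    to′ : m ≡ i ⊕ 1 ⊎ i ⊕ 1 ≡ next m ⊎ m ≡ next (i ⊕ 1) → m ≡ i ⊎ m ≡ i ⊕ 1 ⊎ m ≡ i ⊕ 2
    to′ (inj₁ m≡i+1)          = inj₂ (inj₁ m≡i+1)
    to′ (inj₂ (inj₁ i+1≡m+1)) = inj₁ (sym (next-injective i+1≡m+1))
    to′ (inj₂ (inj₂ m≡i+1+1)) = inj₂ (inj₂ (trans m≡i+1+1 (⊕-assoc i 1 1)))
    from′ : m ≡ i ⊎ m ≡ i ⊕ 1 ⊎ m ≡ i ⊕ 2 → m ≡ i ⊕ 1 ⊎ i ⊕ 1 ≡ next m ⊎ m ≡ next (i ⊕ 1)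
    from′ (inj₁ refl)         = inj₂ (inj₁ refl)
    from′ (inj₂ (inj₁ m≡i+1)) = inj₁ m≡i+1
    from′ (inj₂ (inj₂ m≡i+2)) = inj₂ (inj₂ (trans m≡i+2 (sym (⊕-assoc i 1 1))))

  ∂ : Fin q → Fin q → ℕ
  ∂ i j = cycDist q (toℕ i) (toℕ j)

  cycDist-comm : ∀ a b → cycDist q a b ≡ cycDist q b a
  cycDist-comm a b = cong (λ d → d ⊓ (q ∸ d)) (∣-∣-comm a b)

  cycDist-self : ∀ a → cycDist q a a ≡ 0
  cycDist-self a = cong (λ d → d ⊓ (q ∸ d)) (∣n-n∣≡0 a)

  cycDist-last : ∀ {a b} → suc a ≡ q → suc b < q → cycDist q a b ≡ cycDist q 0 (suc b)
  cycDist-last {a} {b} 1+a≡q 1+b<q = begin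
    ∣ a - b ∣ ⊓ (q ∸ ∣ a - b ∣)      ≡⟨ cong (λ d → d ⊓ (q ∸ d)) ∣a-b∣≡q∸1+b ⟩
    (q ∸ suc b) ⊓ (q ∸ (q ∸ suc b)) ≡⟨ cong ((q ∸ suc b) ⊓_) (m∸[m∸n]≡n (<⇒≤ 1+b<q)) ⟩
    (q ∸ suc b) ⊓ suc b             ≡⟨ ⊓-comm (q ∸ suc b) (suc b) ⟩
    suc b ⊓ (q ∸ suc b)             ∎
    where
    ∣a-b∣≡q∸1+b : ∣ a - b ∣ ≡ q ∸ suc b
    ∣a-b∣≡q∸1+b = trans (m≤n⇒∣n-m∣≡n∸m (<⇒≤ (≤-pred (subst (suc b <_) (sym 1+a≡q) 1+b<q))))
                        (cong (_∸ suc b) 1+a≡q)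

  cycDist-Consec : ∀ {a a′ b b′} → a′ < q → b′ < q → Consec q a a′ → Consec q b b′ →
    cycDist q a′ b′ ≡ cycDist q a b
  cycDist-Consec _    _    (inj₁ refl)        (inj₁ refl)        = refl
  cycDist-Consec _    b′<q (inj₂ (ea , refl)) (inj₁ refl)        = sym (cycDist-last ea b′<q)
  cycDist-Consec {a} {_} {b} a′<q _ (inj₁ refl) (inj₂ (eb , refl)) =
    trans (cycDist-comm _ 0) (trans (sym (cycDist-last eb a′<q)) (cycDist-comm b a))
  cycDist-Consec {a} {_} {b} _ _ (inj₂ (ea , refl)) (inj₂ (eb , refl)) =
    trans (sym (cycDist-self b)) (cong (λ x → cycDist q x b) (suc-injective (trans eb (sym ea))))

  ∂-next : ∀ i j → ∂ (next i) (next j) ≡ ∂ i j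
  ∂-next i j = cycDist-Consec (toℕ<n (next i)) (toℕ<n (next j)) (Consec-next i) (Consec-next j)

  ∂-⊕ : ∀ {i j} s → ∂ (i ⊕ s) (j ⊕ s) ≡ ∂ i j
  ∂-⊕ {i} {j} zero    = cong₂ ∂ (⊕-identityʳ i) (⊕-identityʳ j)
  ∂-⊕ {i} {j} (suc s) = trans (cong₂ ∂ (⊕-suc i s) (⊕-suc j s)) (trans (∂-⊕ s) (∂-next i j))

  ∑-next : ∀ (f : Fin q → ℕ) → ∑[ i < q ] f (next i) ≡ sum f
  ∑-next f = sym (sum-permute f (permutation next prev next∘prev prev∘next))
    where
    prev : Fin q → Fin q
    prev i = i ⊕ (q ∸ 1)
    next∘prev : ∀ i → next (prev i) ≡ i
    next∘prev i = ⊕-inverseˡ i (>-nonZero⁻¹ q)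
    prev∘next : ∀ i → prev (next i) ≡ i
    prev∘next i = ⊕-inverseʳ i (>-nonZero⁻¹ q)

  ∑-⊕ : ∀ s (f : Fin q → ℕ) → ∑[ i < q ] f (i ⊕ s) ≡ sum f
  ∑-⊕ zero    f = sum-cong-≗ (cong f ∘ ⊕-identityʳ)
  ∑-⊕ (suc s) f = trans (sum-cong-≗ (λ i → cong f (⊕-suc i s)))
                        (trans (∑-next (λ i → f (i ⊕ s))) (∑-⊕ s f))

  module ConstantWindowSums (a : Fin q → ℕ) {S}
    (window : ∀ i → a i + a (i ⊕ 1) + a (i ⊕ 2) ≡ S) where

    a-⊕3 : ∀ i → a (i ⊕ 3) ≡ a i
    a-⊕3 i = +-cancelˡ-≡ (a (i ⊕ 1) + a (i ⊕ 2)) _ _ (begin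
      a (i ⊕ 1) + a (i ⊕ 2) + a (i ⊕ 3)
        ≡⟨ cong₂ (λ x y → a (i ⊕ 1) + a x + a y) (⊕-assoc i 1 1) (⊕-assoc i 1 2) ⟨
      a (i ⊕ 1) + a (i ⊕ 1 ⊕ 1) + a (i ⊕ 1 ⊕ 2) ≡⟨ window (i ⊕ 1) ⟩
      S                                         ≡⟨ window i ⟨
      a i + a (i ⊕ 1) + a (i ⊕ 2)               ≡⟨ +-assoc (a i) _ _ ⟩
      a i + (a (i ⊕ 1) + a (i ⊕ 2))             ≡⟨ +-comm (a i) _ ⟩
      a (i ⊕ 1) + a (i ⊕ 2) + a i               ∎)

    a-⊕3k : ∀ k i → a (i ⊕ k * 3) ≡ a i
    a-⊕3k zero    i = cong a (⊕-identityʳ i)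
    a-⊕3k (suc k) i = trans (cong a (sym (⊕-assoc i 3 (k * 3)))) (trans (a-⊕3k k (i ⊕ 3)) (a-⊕3 i))

    a-residue : ∀ i → a i ≡ a (fin (toℕ i % 3))
    a-residue i = begin
      a i                                  ≡⟨ cong a (fin-toℕ i) ⟨
      a (fin (toℕ i))                      ≡⟨ cong (a ∘ fin) (m≡m%n+[m/n]*n (toℕ i) 3) ⟩
      a (fin (toℕ i % 3 + toℕ i / 3 * 3))  ≡⟨ cong a (fin-⊕ _ _) ⟨
      a (fin (toℕ i % 3) ⊕ toℕ i / 3 * 3)  ≡⟨ a-⊕3k (toℕ i / 3) _ ⟩
      a (fin (toℕ i % 3))                  ∎

    window-at-0 : a (fin 0) + a (fin 1) + a (fin 2) ≡ S
    window-at-0 =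
      trans (cong₂ (λ x y → a (fin 0) + a x + a y) (sym (fin-⊕ 0 1)) (sym (fin-⊕ 0 2))) (window (fin 0))

    a-⊕q%3 : ∀ i → a (i ⊕ q % 3) ≡ a i
    a-⊕q%3 i = begin
      a (i ⊕ q % 3)               ≡⟨ a-⊕3k (q / 3) _ ⟨
      a (i ⊕ q % 3 ⊕ q / 3 * 3)   ≡⟨ cong a (⊕-assoc i _ _) ⟩
      a (i ⊕ (q % 3 + q / 3 * 3)) ≡⟨ cong (a ∘ (i ⊕_)) (m≡m%n+[m/n]*n q 3) ⟨
      a (i ⊕ q)                   ≡⟨ cong a (⊕-period i) ⟩
      a i                         ∎

    a-⊕1 : q % 3 ≢ 0 → ∀ i → a (i ⊕ 1) ≡ a i
    a-⊕1 q%3≢0 = by-residue (q % 3) refl (m%n<n q 3)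
      where
      by-residue : ∀ ρ → q % 3 ≡ ρ → ρ < 3 → ∀ i → a (i ⊕ 1) ≡ a i
      by-residue 0 e _ = contradiction e q%3≢0
      by-residue 1 e _ i = subst (λ ρ → a (i ⊕ ρ) ≡ a i) e (a-⊕q%3 i)
      by-residue 2 e _ i = begin
        a (i ⊕ 1)     ≡⟨ subst (λ ρ → a (i ⊕ 1 ⊕ ρ) ≡ a (i ⊕ 1)) e (a-⊕q%3 (i ⊕ 1)) ⟨
        a (i ⊕ 1 ⊕ 2) ≡⟨ cong a (⊕-assoc i 1 2) ⟩
        a (i ⊕ 3)     ≡⟨ a-⊕3 i ⟩
        a i           ∎
      by-residue (suc (suc (suc _))) _ (s≤s (s≤s (s≤s ())))

    a-constant : q % 3 ≢ 0 → ∀ i → 3 * a i ≡ S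
    a-constant q%3≢0 i = begin
      3 * a i                     ≡⟨ cong (λ x → a i + (a i + x)) (+-identityʳ (a i)) ⟩
      a i + (a i + a i)           ≡⟨ +-assoc (a i) _ _ ⟨
      a i + a i + a i             ≡⟨ cong₂ (λ x y → a i + x + y) (a-⊕1 q%3≢0 i) a-⊕2 ⟨
      a i + a (i ⊕ 1) + a (i ⊕ 2) ≡⟨ window i ⟩
      S                           ∎
      where
      a-⊕2 : a (i ⊕ 2) ≡ a i
      a-⊕2 = trans (cong a (sym (⊕-assoc i 1 1))) (trans (a-⊕1 q%3≢0 (i ⊕ 1)) (a-⊕1 q%3≢0 i))

  Diam≤ : ℕ → (Fin q → Bool) → Set
  Diam≤ k P = ∀ i j → T (P i) → T (P j) → ∂ i j ≤ k

  IsUnitBall : (Fin q → Bool) → Set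
  IsUnitBall P = ∃[ m ] ∀ i → T (P i) ⇔ Near m i

  Diam≤-⊕ : ∀ {k P} s → Diam≤ k P → Diam≤ k (λ i → P (i ⊕ s))
  Diam≤-⊕ s diam i j Pi Pj = subst (_≤ _) (∂-⊕ s) (diam _ _ Pi Pj)

  IsUnitBall-⊕ : ∀ {P s} → s ≤ q → IsUnitBall (λ i → P (i ⊕ s)) → IsUnitBall P
  IsUnitBall-⊕ {P} {s} s≤q (m , ball) = m ⊕ s , λ j → ball′ (⊕-surjective s≤q j)
    where
    ball′ : ∀ {j} → ∃[ i ] i ⊕ s ≡ j → T (P j) ⇔ Near (m ⊕ s) j
    ball′ (i , refl) = ⇔-trans (ball i) (⇔-sym (Near-⊕ s))

  count-⊕ : ∀ {P} s → count (λ i → P (i ⊕ s)) ≡ count P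
  count-⊕ {P} s = ∑-⊕ s (χ ∘ P)

-- Small subsets of the cycle, studied after rotating them to a fixed position

k≤k+r∸t : ∀ k {r t} → t ≤ r → k ≤ k + r ∸ t
k≤k+r∸t k {r} {t} t≤r = ≤-trans (m≤m+n k (r ∸ t)) (≤-reflexive (sym (+-∸-assoc k t≤r)))

pattern 5+_ u = fsuc (fsuc (fsuc (fsuc (fsuc u))))

module DiameterTwo (r : ℕ) where

  open CycleGraph (7 + r)

  CountBound : ℕ → (Fin (7 + r) → Bool) → Set
  CountBound c P = c ≤ 3 × (c ≡ 3 → IsUnitBall P)

  Diam≤2⇒CountBound-2F : ∀ {P} → T (P 2F) → Diam≤ 2 P → CountBound (count P) P
  Diam≤2⇒CountBound-2F {P} P₂ diam = subst (λ c → CountBound c P) (sym count≡)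
    (shape (P 0F) (P 1F) (P 3F) (P 4F) refl refl refl refl)
    where
    beyond : ∀ u → P (5+ u) ≡ false
    beyond u with P (5+ u) in e
    ... | false = refl
    ... | true  = contradiction (diam 2F (5+ u) P₂ (from T-≡ e))
                    (<⇒≱ (⊓-glb (m≤m+n 3 _) (k≤k+r∸t 3 (≤-pred (toℕ<n u)))))

    P₂≡ : P 2F ≡ true
    P₂≡ = to T-≡ P₂

    apart : ∀ {i j} → P i ≡ true → P j ≡ true → ∂ i j ≤ 2
    apart Pi Pj = diam _ _ (from T-≡ Pi) (from T-≡ Pj)

    count≡ : count P ≡ χ (P 0F) + (χ (P 1F) + (1 + (χ (P 3F) + (χ (P 4F) + 0))))
    count≡ = cong₂ (λ b c → χ (P 0F) + (χ (P 1F) + (χ b + (χ (P 3F) + (χ (P 4F) + c)))))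
      P₂≡ (count-none (λ u → subst T (beyond u)))

    -- does (Near? m i) computes for numerals m and i, so the equations e₀ … e₄ of shape
    -- below already have the types required here.
    ball : ∀ m → 1 ≤ toℕ m → toℕ m ≤ 3 →
      P 0F ≡ does (Near? m 0F) → P 1F ≡ does (Near? m 1F) → P 2F ≡ does (Near? m 2F) →
      P 3F ≡ does (Near? m 3F) → P 4F ≡ does (Near? m 4F) → IsUnitBall P
    ball m 1≤m m≤3 e₀ e₁ e₂ e₃ e₄ =
      m , λ i → ⇔-trans (subst (λ b → T (P i) ⇔ T b) (agree i) ⇔-refl) (T-does⇔ (Near? m i))
      where
      agree : ∀ i → P i ≡ does (Near? m i)
      agree 0F     = e₀
      agree 1F     = e₁
      agree 2F     = e₂
      agree 3F     = e₃
      agree 4F     = e₄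
      agree (5+ u) = trans (beyond u) (sym (dec-false (Near? m (5+ u))
        (λ near → m+1+n≰m 4 (≤-trans (Near-bound near 1≤m) (s≤s m≤3)))))

    shape : ∀ b₀ b₁ b₃ b₄ → P 0F ≡ b₀ → P 1F ≡ b₁ → P 3F ≡ b₃ → P 4F ≡ b₄ →
      CountBound (χ b₀ + (χ b₁ + (1 + (χ b₃ + (χ b₄ + 0))))) P
    shape true  _     true  _     e₀ _  e₃ _  = contradiction (apart e₀ e₃) (<⇒≱ (m≤m+n 3 _))
    shape true  _     false true  e₀ _  _  e₄ = contradiction (apart e₀ e₄) (<⇒≱ (m≤m+n 3 _))
    shape false true  _     true  _  e₁ _  e₄ = contradiction (apart e₁ e₄) (<⇒≱ (m≤m+n 3 _))
    shape true  true  false false e₀ e₁ e₃ e₄ = ≤-refl , λ _ → ball 1F (s≤s z≤n) (s≤s z≤n) e₀ e₁ P₂≡ e₃ e₄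
    shape false true  true  false e₀ e₁ e₃ e₄ = ≤-refl , λ _ → ball 2F (s≤s z≤n) (s≤s (s≤s z≤n)) e₀ e₁ P₂≡ e₃ e₄
    shape false false true  true  e₀ e₁ e₃ e₄ = ≤-refl , λ _ → ball 3F (s≤s z≤n) ≤-refl e₀ e₁ P₂≡ e₃ e₄
    shape true  false false false _  _  _  _  = n≤1+n _ , λ ()
    shape false true  false false _  _  _  _  = n≤1+n _ , λ ()
    shape false false true  false _  _  _  _  = n≤1+n _ , λ ()
    shape false false false true  _  _  _  _  = n≤1+n _ , λ ()
    shape false false false false _  _  _  _  = m≤n⇒m≤1+n (n≤1+n _) , λ ()

  Diam≤2⇒CountBound : ∀ {P} → Diam≤ 2 P → CountBound (count P) P
  Diam≤2⇒CountBound {P} diam with any? (λ i → T? (P i))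
  ... | no ∄P = subst (λ c → CountBound c P) (sym (count-none (λ i Pi → ∄P (i , Pi)))) (z≤n , λ ())
  ... | yes (a , Pa) with s , s<q , refl ← ⊕-reach 2F a =
    subst (λ c → CountBound c P) (count-⊕ {P} s) (Prod.map₂ (IsUnitBall-⊕ (<⇒≤ s<q) ∘_)
      (Diam≤2⇒CountBound-2F {λ i → P (i ⊕ s)} Pa (Diam≤-⊕ s diam)))

module NestedNeighbourhoods (r : ℕ) where

  open CycleGraph (6 + r)

  Near-⊆⇒≡-3F : ∀ {i} → (∀ j → Near i j → Near 3F j) → i ≡ 3F
  Near-⊆⇒≡-3F {i} ⊆N[3] with to Near⇔ (⊆N[3] i Near-refl)
  ... | inj₁ 3≡i         = sym 3≡i
  ... | inj₂ (inj₁ refl) =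
    contradiction (Near-bound (⊆N[3] 5F (consecutive⇒Near refl)) (s≤s z≤n)) (m+1+n≰m 4)
  ... | inj₂ (inj₂ 3≡i+1) with next-injective {i} {2F} (sym 3≡i+1)
  ...   | refl =
    contradiction (Near-bound (Near-sym (⊆N[3] 1F (Near-sym (consecutive⇒Near refl)))) (s≤s z≤n)) (m+1+n≰m 2)

  Near-⊆⇒≡ : ∀ {i m} → (∀ j → Near i j → Near m j) → i ≡ m
  Near-⊆⇒≡ {i} {m} ⊆N[m] with ⊕-reach 3F m
  ... | s , s<q , refl with ⊕-surjective (<⇒≤ s<q) i
  ...   | i′ , refl =
    cong (_⊕ s) (Near-⊆⇒≡-3F λ j i′~j → to (Near-⊕ s) (⊆N[m] (j ⊕ s) (from (Near-⊕ {i′} s) i′~j)))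

pattern 9+_ u = 5+ fsuc (fsuc (fsuc (fsuc u)))

module CloseNeighbourhoods (r : ℕ) where

  open CycleGraph (9 + r)

  Spread≤3 : Fin (9 + r) → Fin (9 + r) → Set
  Spread≤3 i j = ∀ k l → Near i k → Near j l → ∂ k l ≤ 3

  private
    5~4 : Near 5F 4F
    5~4 = Near-sym (consecutive⇒Near refl)

    5~6 : Near 5F 6F
    5~6 = consecutive⇒Near refl

  Spread≤3⇒Near-5F : ∀ j → Spread≤3 5F j → Near 5F j
  Spread≤3⇒Near-5F 0F     sp = contradiction (sp 5F 0F Near-refl Near-refl) (<⇒≱ (m≤m+n 4 _))
  Spread≤3⇒Near-5F 1F     sp = contradiction (sp 5F 1F Near-refl Near-refl) (<⇒≱ ≤-refl)
  Spread≤3⇒Near-5F 2F     sp = contradiction (sp 6F 2F 5~6 Near-refl) (<⇒≱ ≤-refl)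
  Spread≤3⇒Near-5F 3F     sp = contradiction (sp 6F 2F 5~6 (Near-sym (consecutive⇒Near refl))) (<⇒≱ ≤-refl)
  Spread≤3⇒Near-5F 4F     _  = Near-sym (consecutive⇒Near refl)
  Spread≤3⇒Near-5F 5F     _  = Near-refl
  Spread≤3⇒Near-5F 6F     _  = 5~6
  Spread≤3⇒Near-5F 7F     sp = contradiction (sp 4F 8F 5~4 (consecutive⇒Near refl)) (<⇒≱ ≤-refl)
  Spread≤3⇒Near-5F 8F     sp = contradiction (sp 4F 8F 5~4 Near-refl) (<⇒≱ ≤-refl)
  Spread≤3⇒Near-5F (9+ u) sp = contradiction (sp 5F (9+ u) Near-refl Near-refl)
    (<⇒≱ (⊓-glb (m≤m+n 4 _) (k≤k+r∸t 4 (m<n⇒m≤1+n (toℕ<n u)))))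

  Spread≤3⇒Near : ∀ {i j} → Spread≤3 i j → Near i j
  Spread≤3⇒Near {i} {j} sp with ⊕-reach 5F i
  ... | s , s<q , refl with ⊕-surjective (<⇒≤ s<q) j
  ...   | j′ , refl =
    from (Near-⊕ s) (Spread≤3⇒Near-5F j′ λ k l 5~k j′~l →
      subst (_≤ 3) (∂-⊕ {k} {l} s) (sp (k ⊕ s) (l ⊕ s) (from (Near-⊕ s) 5~k) (from (Near-⊕ s) j′~l)))

-- Closed neighbourhoods and walks in a graph

module Neighbourhoods {n} (G : Graph n) where

  N[_] : Fin n → Fin n → Bool
  N[ x ] w = does (w ≟ x) ∨ adj G x w

  ∈N[]⇔ : ∀ {x w} → T (N[ x ] w) ⇔ (w ≡ x ⊎ Adj G x w)
  ∈N[]⇔ {x} {w} with w ≟ x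
  ... | yes w≡x = mk⇔ (λ _ → inj₁ w≡x) (λ _ → tt)
  ... | no  w≢x = mk⇔ inj₂ [ (λ w≡x → contradiction w≡x w≢x) , id ]

  Adj-sym : ∀ {x y} → Adj G x y → Adj G y x
  Adj-sym {x} {y} = subst T (Graph.sym G x y)

  count-N[] : ∀ {δ} → Regular G δ → ∀ x → count N[ x ] ≡ δ + 1
  count-N[] {δ} regular x = begin
    count N[ x ]      ≡⟨ count-insert (adj G x) x (irrefl G x) ⟩
    suc (count (adj G x)) ≡⟨ cong suc (length-filter-tabulate (λ w → T? (adj G x w)) id) ⟨
    suc (degree G x)  ≡⟨ cong suc (regular x) ⟩
    suc δ             ≡⟨ +-comm 1 δ ⟩
    δ + 1             ∎
    where open ≡-Reasoning

  Reach : Fin n → Fin n → ℕ → Set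
  Reach x y k = ∃[ l ] l ≤ k × Walk G x y l

  Reach-trans : ∀ {x y z k l} → Reach x y k → Reach y z l → Reach x z (k + l)
  Reach-trans (l₁ , l₁≤k , w₁) (l₂ , l₂≤l , w₂) = l₁ + l₂ , +-mono-≤ l₁≤k l₂≤l , w₁ ++ w₂
    where
    _++_ : ∀ {x y z k l} → Walk G x y k → Walk G y z l → Walk G x z (k + l)
    here     ++ w′ = w′
    step a w ++ w′ = step a (w ++ w′)

  Adj⇒Reach : ∀ {x y} → Adj G x y → Reach x y 1
  Adj⇒Reach x~y = 1 , ≤-refl , step x~y here

  ∈N[]⇒Reach : ∀ {x w} → T (N[ x ] w) → Reach x w 1
  ∈N[]⇒Reach w∈N[x] with to ∈N[]⇔ w∈N[x]
  ... | inj₁ refl = 0 , z≤n , here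
  ... | inj₂ x~w  = Adj⇒Reach x~w

  ∈N[]⇒Reach⁻ : ∀ {x w} → T (N[ x ] w) → Reach w x 1
  ∈N[]⇒Reach⁻ w∈N[x] with to ∈N[]⇔ w∈N[x]
  ... | inj₁ refl = 0 , z≤n , here
  ... | inj₂ x~w  = Adj⇒Reach (Adj-sym x~w)

-- The partition of an equatorial graph

module EquatorialPartition {n} (G : Graph n) {δ} (regular : Regular G δ)
  {r} (C : Cycle G (9 + r)) (isometric : Isometric C) (order : 3 * n ≡ (9 + r) * (δ + 1)) where

  open Neighbourhoods G
  open CycleGraph (9 + r)
  open DiameterTwo (2 + r) using (Diam≤2⇒CountBound)
  open NestedNeighbourhoods (3 + r) using (Near-⊆⇒≡)
  open CloseNeighbourhoods r using (Spread≤3⇒Near)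
  open ≡-Reasoning

  c : Fin (9 + r) → Fin n
  c = vertex C

  ∂-≤ : ∀ {i j k} → Reach (c i) (c j) k → ∂ i j ≤ k
  ∂-≤ {i} {j} (l , l≤k , walk) = ≤-trans (≮⇒≥ λ l<∂ → proj₂ (isometric i j) l l<∂ walk) l≤k

  Near⇒∈N[] : ∀ {i j} → Near i j → T (N[ c i ] (c j))
  Near⇒∈N[] (inj₁ refl)            = from ∈N[]⇔ (inj₁ refl)
  Near⇒∈N[] (inj₂ (inj₁ i→j))      = from ∈N[]⇔ (inj₂ (edges C _ _ i→j))
  Near⇒∈N[] (inj₂ (inj₂ j→i))      = from ∈N[]⇔ (inj₂ (Adj-sym (edges C _ _ j→i)))

  covered : Fin n → Fin (9 + r) → Bool
  covered v i = N[ c i ] v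

  covered-Diam≤2 : ∀ v → Diam≤ 2 (covered v)
  covered-Diam≤2 v i j v∈N[cᵢ] v∈N[cⱼ] = ∂-≤ (Reach-trans (∈N[]⇒Reach v∈N[cᵢ]) (∈N[]⇒Reach⁻ v∈N[cⱼ]))

  ∑-count-covered : ∑[ v < n ] count (covered v) ≡ ∑[ v < n ] 3
  ∑-count-covered = begin
    ∑[ v < n ] ∑[ i < 9 + r ] χ (N[ c i ] v) ≡⟨ ∑-comm (λ v i → χ (N[ c i ] v)) ⟩
    ∑[ i < 9 + r ] count N[ c i ]           ≡⟨ sum-cong-≗ (count-N[] regular ∘ c) ⟩
    ∑[ i < 9 + r ] (δ + 1)                  ≡⟨ ∑-const (9 + r) (δ + 1) ⟩
    (9 + r) * (δ + 1)                       ≡⟨ order ⟨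
    3 * n                                   ≡⟨ *-comm 3 n ⟩
    n * 3                                   ≡⟨ ∑-const n 3 ⟨
    ∑[ v < n ] 3                            ∎

  count-covered : ∀ v → count (covered v) ≡ 3
  count-covered = ∑-tight (λ v → proj₁ (Diam≤2⇒CountBound (covered-Diam≤2 v))) ∑-count-covered

  covered-ball : ∀ v → IsUnitBall (covered v)
  covered-ball v = proj₂ (Diam≤2⇒CountBound (covered-Diam≤2 v)) (count-covered v)

  part : Fin n → Fin (9 + r)
  part v = proj₁ (covered-ball v)

  covered⇔ : ∀ v i → T (covered v i) ⇔ Near (part v) i
  covered⇔ v = proj₂ (covered-ball v)

  part-c : ∀ i → part (c i) ≡ i
  part-c i = sym (Near-⊆⇒≡ λ j i~j → to (covered⇔ (c i) j) (Near⇒∈N[] (Near-sym i~j)))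

  Adj⇒Near : ∀ {u v} → Adj G u v → Near (part u) (part v)
  Adj⇒Near {u} {v} u~v = Spread≤3⇒Near λ k l pu~k pv~l → ∂-≤
    (Reach-trans (Reach-trans (∈N[]⇒Reach (from (covered⇔ u k) pu~k)) (Adj⇒Reach u~v))
                 (∈N[]⇒Reach⁻ (from (covered⇔ v l) pv~l)))

  Near⇒Adj : ∀ {u v} → u ≢ v → Near (part u) (part v) → Adj G u v
  Near⇒Adj {u} {v} u≢v pu~pv = [ (λ v≡u → contradiction (sym v≡u) u≢v) , id ] (to ∈N[]⇔ v∈N[u])
    where
    -- N[u] ⊆ N[c (part u)], and both have δ + 1 elements.
    N[u]⊆ : ∀ w → T (N[ u ] w) → T (covered w (part u))
    N[u]⊆ w w∈N[u] with to ∈N[]⇔ w∈N[u]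
    ... | inj₁ refl = from (covered⇔ u (part u)) Near-refl
    ... | inj₂ u~w  = from (covered⇔ w (part u)) (Near-sym (Adj⇒Near u~w))
    v∈N[u] : T (N[ u ] v)
    v∈N[u] = count-⊆⇒⊇ N[u]⊆ (trans (count-N[] regular u) (sym (count-N[] regular (c (part u)))))
      v (from (covered⇔ v (part u)) (Near-sym pu~pv))

  size : Fin (9 + r) → ℕ
  size = partSize part

  in-part : Fin (9 + r) → Fin n → Bool
  in-part i v = does (part v ≟ i)

  size≡count : ∀ i → size i ≡ count (in-part i)
  size≡count i = length-filter-tabulate (λ v → part v ≟ i) id

  size-pos : ∀ i → 1 ≤ size i
  size-pos i = subst (1 ≤_) (sym (size≡count i))
    (count-≥1 (c i) (from (T-does⇔ (part (c i) ≟ i)) (part-c i)))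

  size-window : ∀ i → size i + size (i ⊕ 1) + size (i ⊕ 2) ≡ δ + 1
  size-window i = begin
    size i + size (i ⊕ 1) + size (i ⊕ 2)
      ≡⟨ cong₂ _+_ (cong₂ _+_ (size≡count i) (size≡count (i ⊕ 1))) (size≡count (i ⊕ 2)) ⟩
    count (in-part i) + count (in-part (i ⊕ 1)) + count (in-part (i ⊕ 2))
      ≡⟨ cong (_+ count (in-part (i ⊕ 2))) (∑-distrib-+ (χ ∘ in-part i) (χ ∘ in-part (i ⊕ 1))) ⟨
    ∑[ v < n ] (χ (in-part i v) + χ (in-part (i ⊕ 1) v)) + count (in-part (i ⊕ 2))
      ≡⟨ ∑-distrib-+ (λ v → χ (in-part i v) + χ (in-part (i ⊕ 1) v)) (χ ∘ in-part (i ⊕ 2)) ⟨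
    ∑[ v < n ] (χ (in-part i v) + χ (in-part (i ⊕ 1) v) + χ (in-part (i ⊕ 2) v))
      ≡⟨ sum-cong-≗ (λ v → χ-one-of-three i≢i+1 i≢i+2 i+1≢i+2
                             (⇔-trans (covered⇔ v (i ⊕ 1)) Near-⊕1⇔)) ⟨
    count N[ c (i ⊕ 1) ]
      ≡⟨ count-N[] regular (c (i ⊕ 1)) ⟩
    δ + 1 ∎
    where
    i≢i+1 : i ≢ i ⊕ 1
    i≢i+1 e = contradiction (⊕-injectiveʳ i (s≤s z≤n) (s≤s (s≤s z≤n)) (trans (⊕-identityʳ i) e)) λ ()
    i≢i+2 : i ≢ i ⊕ 2
    i≢i+2 e = contradiction (⊕-injectiveʳ i (s≤s z≤n) (s≤s (s≤s (s≤s z≤n))) (trans (⊕-identityʳ i) e)) λ ()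
    i+1≢i+2 : i ⊕ 1 ≢ i ⊕ 2
    i+1≢i+2 e = contradiction (⊕-injectiveʳ i (s≤s (s≤s z≤n)) (s≤s (s≤s (s≤s z≤n))) e) λ ()

3*m≡n+1⇒n%3≡2 : ∀ {m n} → 3 * m ≡ n + 1 → n % 3 ≡ 2
3*m≡n+1⇒n%3≡2 {zero}  {n} e = contradiction (trans e (+-comm n 1)) λ ()
3*m≡n+1⇒n%3≡2 {suc k} {n} e = trans (cong (_% 3) n≡2+k*3) ([m+kn]%n≡m%n 2 k 3)
  where
  open ≡-Reasoning
  n≡2+k*3 : n ≡ 2 + k * 3
  n≡2+k*3 = suc-injective (begin
    suc n       ≡⟨ +-comm 1 n ⟩
    n + 1       ≡⟨ e ⟨
    3 * suc k   ≡⟨ *-suc 3 k ⟩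
    3 + 3 * k   ≡⟨ cong (3 +_) (*-comm 3 k) ⟩
    3 + k * 3   ∎)

theorem29 : ∀ {n} (G : Graph n) (δ q : ℕ) →
  2 ≤ δ → Regular G δ → MinDegree G δ → Girth G 3 → Equator G q →
  9 < q → 3 * n ≡ q * (δ + 1) →
  ((q % 3 ≡ 0) ⊎ (δ % 3 ≡ 2))
  × Σ (Fin n → Fin q) (λ part →
      (∀ i → Σ (Fin n) (λ v → part v ≡ i))
      × (∀ u v → u ≢ v → (Adj G u v ⇔
           ((part u ≡ part v)
            ⊎ Consec q (toℕ (part u)) (toℕ (part v))
            ⊎ Consec q (toℕ (part v)) (toℕ (part u)))))
      × ((q % 3 ≡ 0) →
           Σ ℕ (λ n₀ → Σ ℕ (λ n₁ → Σ ℕ (λ n₂ →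
             (1 ≤ n₀) × (1 ≤ n₁) × (1 ≤ n₂) × (n₀ + n₁ + n₂ ≡ δ + 1)
             × (∀ i → ((toℕ i % 3 ≡ 0) → partSize part i ≡ n₀)
                    × ((toℕ i % 3 ≡ 1) → partSize part i ≡ n₁)
                    × ((toℕ i % 3 ≡ 2) → partSize part i ≡ n₂))))))
      × ((q % 3 ≢ 0) → ∀ i → 3 * partSize part i ≡ δ + 1))
theorem29 G δ q _ regular _ _ ((C , isometric) , _) 9<q order with m≤n⇒∃[o]m+o≡n 9<q
... | r , refl =
  residues , part , (λ i → c i , part-c i) , (λ _ _ u≢v → mk⇔ Adj⇒Near (Near⇒Adj u≢v)) ,
  (λ _ → size (fin 0) , size (fin 1) , size (fin 2) , size-pos _ , size-pos _ , size-pos _ , window-at-0 ,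
         λ i → by-residue i , by-residue i , by-residue i) ,
  a-constant
  where
  open EquatorialPartition G regular C isometric order
  open CycleGraph (10 + r) using (fin; module ConstantWindowSums)
  open ConstantWindowSums size size-window
  by-residue : ∀ i {ρ} → toℕ i % 3 ≡ ρ → size i ≡ size (fin ρ)
  by-residue i e = trans (a-residue i) (cong (size ∘ fin) e)
  residues : (10 + r) % 3 ≡ 0 ⊎ δ % 3 ≡ 2
  residues with (10 + r) % 3 ≟ℕ 0
  ... | yes q%3≡0 = inj₁ q%3≡0
  ... | no  q%3≢0 = inj₂ (3*m≡n+1⇒n%3≡2 {size (fin 0)} (a-constant q%3≢0 (fin 0)))
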